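{- Suppose that there exists a Kirkman frame of type $(4g)^u$ with a $4$-colouring in which the points of each group are coloured equitably. Further, suppose that there exists a Kirkman triple system of order $4g+1$ with chromatic number $4$ that admits an equitable $4$-colouring. Then there exists a Kirkman triple system of order $4gu+1$ with chromatic number $4$ that admits an equitable $4$-colouring.
   Context: A $3$-GDD is a triple $(V,\mathcal{G},\mathcal{B})$ where $\mathcal{G}$ partitions $V$ into groups and $\mathcal{B}$ is a set of $3$-subsets (blocks) such that every pair of points in different groups lies in exactly one block and no block meets a group in more than one point; type $g^u$ means $u$ groups of size $g$. A Kirkman frame is a $3$-GDD with a partition of its blocks into partial parallel classes, each a partition of $V\setminus G$ for some group $G$. A Kirkman triple system KTS$(n)$ is a Steiner triple system on $n$ points together with a partition of its triples into parallel classes. A $4$-colouring maps points to $4$ colours with no monochromatic block; it is equitable (on a set of points) if the sizes of colour classes differ by at most one. The chromatic number is the least $\delta$ admitting a $\delta$-colouring. -}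

module Defs where

open import Data.Nat using (ℕ; suc; _≤_; _<_)
open import Data.Fin as Fin using (Fin)
import Data.Fin.Properties as FinP
import Data.Product.Properties as ProdP
open import Data.Product using (Σ; ∃; _×_; _,_; proj₁)
open import Data.Sum using (_⊎_)
open import Data.List using (List; length; filter; concatMap; allFin; map)
open import Data.List.Relation.Unary.All using (All)
open import Relation.Nullary using (¬_; Dec)
open import Relation.Nullary.Decidable using (_×-dec_; _⊎-dec_)
open import Relation.Binary.PropositionalEquality using (_≡_; _≢_)
open import Relation.Binary.Definitions using (DecidableEquality)

-- Blocks: 3-subsets, represented as triples of pairwise distinct points.

record Triple (P : Set) : Set where
  constructor tri
  field
    a b c : P
    a≢b : a ≢ b
    a≢c : a ≢ c
    b≢c : b ≢ c
open Triple public

_∈T_ : {P : Set} → P → Triple P → Set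
x ∈T B = x ≡ a B ⊎ x ≡ b B ⊎ x ≡ c B

module Counting {P : Set} (_≟_ : DecidableEquality P) where

  _∈T?_ : (x : P) (B : Triple P) → Dec (x ∈T B)
  x ∈T? B = (x ≟ a B) ⊎-dec ((x ≟ b B) ⊎-dec (x ≟ c B))

  countPt : P → List (Triple P) → ℕ
  countPt x bs = length (filter (λ B → x ∈T? B) bs)

  countPair : P → P → List (Triple P) → ℕ
  countPair x y bs = length (filter (λ B → (x ∈T? B) ×-dec (y ∈T? B)) bs)

-- Kirkman triple systems KTS(n) on the point set Fin n:
-- the triples are given already partitioned into r parallel classes.

record KTS (n : ℕ) : Set where
  open Counting (FinP._≟_ {n})
  field
    r       : ℕ
    classes : Fin r → List (Triple (Fin n))
  blocks : List (Triple (Fin n))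
  blocks = concatMap classes (allFin r)
  field
    parallel : ∀ (i : Fin r) (x : Fin n) → countPt x (classes i) ≡ 1
    steiner  : ∀ (x y : Fin n) → x ≢ y → countPair x y blocks ≡ 1

-- Kirkman frames of type m^u on the point set Fin u × Fin m,
-- the groups being { i } × Fin m  (i : Fin u).

FPt : ℕ → ℕ → Set
FPt m u = Fin u × Fin m

_≟F_ : ∀ {m u} → DecidableEquality (FPt m u)
_≟F_ = ProdP.≡-dec FinP._≟_ FinP._≟_

record KirkmanFrame (m u : ℕ) : Set where
  open Counting (_≟F_ {m} {u})
  field
    r       : ℕ
    classes : Fin r → List (Triple (FPt m u))
    -- the group G_i = { hole i } × Fin m missed by the partial class i
    hole    : Fin r → Fin u
  blocks : List (Triple (FPt m u))
  blocks = concatMap classes (allFin r)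
  field
    transversal : All (λ B → proj₁ (a B) ≢ proj₁ (b B) × proj₁ (a B) ≢ proj₁ (c B)
                                × proj₁ (b B) ≢ proj₁ (c B)) blocks
    gdd : ∀ (x y : FPt m u) → proj₁ x ≢ proj₁ y → countPair x y blocks ≡ 1
    partialParallel : ∀ (i : Fin r) (x : FPt m u) →
      (proj₁ x ≡ hole i → countPt x (classes i) ≡ 0) ×
      (proj₁ x ≢ hole i → countPt x (classes i) ≡ 1)

Proper : {P : Set} {δ : ℕ} → List (Triple P) → (P → Fin δ) → Set
Proper bs col = All (λ B → ¬ (col (a B) ≡ col (b B) × col (b B) ≡ col (c B))) bs

Colourable : {P : Set} → List (Triple P) → ℕ → Set
Colourable {P} bs δ = Σ (P → Fin δ) (Proper bs)

HasChromaticNumber : {P : Set} → List (Triple P) → ℕ → Set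
HasChromaticNumber bs δ = Colourable bs δ × (∀ δ' → δ' < δ → ¬ Colourable bs δ')

colourCount : {P : Set} {δ : ℕ} → (P → Fin δ) → List P → Fin δ → ℕ
colourCount col L k = length (filter (λ x → col x Fin.≟ k) L)

EquitableOn : {P : Set} {δ : ℕ} → (P → Fin δ) → List P → Set
EquitableOn col L = ∀ k k' → colourCount col L k ≤ suc (colourCount col L k')

groupPts : ∀ {m u} → Fin u → List (FPt m u)
groupPts {m} i = map (i ,_) (allFin m)

Good4KTS : ℕ → Set
Good4KTS n = Σ (KTS n) λ K → HasChromaticNumber (KTS.blocks K) 4 ×
               Σ (Fin n → Fin 4) λ col → Proper (KTS.blocks K) col × EquitableOn col (allFin n)

-- Adjoin a point ∞ to the frame and fill every group G with a copy of the KTS(4g+1) on G ∪ {∞}.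
-- An equitable 4-colouring of the 4g points of G uses each colour g times, and one of 4g+1 points
-- uses some colour κ exactly g+1 times and the others g times; colouring ∞ with κ, the points of
-- the KTS can therefore be identified with G ∪ {∞} so that colours are preserved. Counting pairs
-- through a point shows that each group is the hole of exactly 2g partial parallel classes, which
-- is the number of parallel classes of the KTS, so every partial class missing G is completed to a
-- parallel class by its own parallel class of the copy on G ∪ {∞}. The resulting system is
-- properly and equitably 4-coloured, and it is not 3-colourable because it contains a copy of the
-- KTS(4g+1).

module Submission where

open import Defs
open import Data.Nat using (ℕ; zero; suc; _+_; _*_; _∸_; _≤_; _<_; z≤n; s≤s)
open import Data.Nat.Properties hiding (_≟_)
open import Data.Nat.Tactic.RingSolver using (solve-∀)
open import Algebra.Properties.CommutativeSemigroup +-commutativeSemigroup using (interchange; x∙yz≈y∙xz)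
open import Data.Fin as Fin using (Fin)
import Data.Fin.Properties as FinP
open import Data.Maybe using (Maybe; just; nothing)
import Data.Maybe.Properties as MaybeP
open import Data.Product using (Σ; ∃; ∃-syntax; _×_; _,_; proj₁; proj₂)
import Data.Product.Properties as ProdP
open import Data.Unit using (tt)
import Data.Unit.Properties as UnitP
open import Data.Sum using (_⊎_; inj₁; inj₂)
open import Data.Empty using (⊥; ⊥-elim)
open import Data.List using (List; []; _∷_; _++_; length; filter; map; concatMap; allFin; cartesianProduct)
import Data.List.Properties as ListP
open import Function using (_∘_; id)
open import Data.List.Relation.Unary.All as All using (All)
open import Data.List.Membership.Propositional using (_∈_)
open import Data.List.Membership.Propositional.Properties using (∈-allFin)
import Data.List.Relation.Unary.All.Properties as AllP
open import Level using (0ℓ)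
open import Relation.Nullary using (¬_; Dec; yes; no)
open import Relation.Nullary.Decidable using (_×-dec_; _⊎-dec_)
open import Relation.Unary using (Pred; Decidable)
open import Relation.Binary.Definitions using (DecidableEquality)
open import Relation.Binary.PropositionalEquality

private
  variable
    A B C : Set

𝟙 : {P : Set} → Dec P → ℕ
𝟙 (yes _) = 1
𝟙 (no _)  = 0

𝟙-yes : {P : Set} (p? : Dec P) → P → 𝟙 p? ≡ 1
𝟙-yes (yes _) _ = refl
𝟙-yes (no ¬p) p = ⊥-elim (¬p p)

𝟙-no : {P : Set} (p? : Dec P) → ¬ P → 𝟙 p? ≡ 0
𝟙-no (yes p) ¬p = ⊥-elim (¬p p)
𝟙-no (no _)  _  = refl

𝟙≤1 : {P : Set} (p? : Dec P) → 𝟙 p? ≤ 1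
𝟙≤1 (yes _) = s≤s z≤n
𝟙≤1 (no _)  = z≤n

𝟙-cong : {P Q : Set} → (P → Q) → (Q → P) → (p? : Dec P) (q? : Dec Q) → 𝟙 p? ≡ 𝟙 q?
𝟙-cong to from (yes p) q? = sym (𝟙-yes q? (to p))
𝟙-cong to from (no ¬p) q? = sym (𝟙-no q? (¬p ∘ from))

𝟙-× : {P Q : Set} (p? : Dec P) (q? : Dec Q) → 𝟙 (p? ×-dec q?) ≡ 𝟙 p? * 𝟙 q?
𝟙-× (yes _) (yes _) = refl
𝟙-× (yes _) (no _)  = refl
𝟙-× (no _)  _       = refl

𝟙-⊎ : {P Q : Set} (p? : Dec P) (q? : Dec Q) → ¬ (P × Q) → 𝟙 (p? ⊎-dec q?) ≡ 𝟙 p? + 𝟙 q?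
𝟙-⊎ (yes p) (yes q) ¬pq = ⊥-elim (¬pq (p , q))
𝟙-⊎ (yes _) (no _)  _   = refl
𝟙-⊎ (no _)  (yes _) _   = refl
𝟙-⊎ (no _)  (no _)  _   = refl

∑ : (A → ℕ) → List A → ℕ
∑ f []       = 0
∑ f (x ∷ xs) = f x + ∑ f xs

syntax ∑ (λ x → e) xs = ∑[ x ∈ xs ] e

length-filter≡∑𝟙 : {P : Pred A 0ℓ} (P? : Decidable P) (xs : List A) →
                    length (filter P? xs) ≡ ∑[ x ∈ xs ] 𝟙 (P? x)
length-filter≡∑𝟙 P? []       = refl
length-filter≡∑𝟙 P? (x ∷ xs) with P? x
... | yes _ = cong suc (length-filter≡∑𝟙 P? xs)
... | no _  = length-filter≡∑𝟙 P? xs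

∑-cong : {f g : A → ℕ} (xs : List A) → (∀ x → f x ≡ g x) → ∑ f xs ≡ ∑ g xs
∑-cong []       f≗g = refl
∑-cong (x ∷ xs) f≗g = cong₂ _+_ (f≗g x) (∑-cong xs f≗g)

∑-++ : (f : A → ℕ) (xs ys : List A) → ∑ f (xs ++ ys) ≡ ∑ f xs + ∑ f ys
∑-++ f []       ys = refl
∑-++ f (x ∷ xs) ys = trans (cong (f x +_) (∑-++ f xs ys)) (sym (+-assoc (f x) _ _))

∑-+ : (f g : A → ℕ) (xs : List A) → ∑[ x ∈ xs ] (f x + g x) ≡ ∑ f xs + ∑ g xs
∑-+ f g []       = refl
∑-+ f g (x ∷ xs) = trans (cong (f x + g x +_) (∑-+ f g xs)) (interchange (f x) (g x) _ _)

∑-*ˡ : (c : ℕ) (f : A → ℕ) (xs : List A) → ∑[ x ∈ xs ] (c * f x) ≡ c * ∑ f xs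
∑-*ˡ c f []       = sym (*-zeroʳ c)
∑-*ˡ c f (x ∷ xs) = trans (cong (c * f x +_) (∑-*ˡ c f xs)) (sym (*-distribˡ-+ c (f x) _))

∑-*ʳ : (c : ℕ) (f : A → ℕ) (xs : List A) → ∑[ x ∈ xs ] (f x * c) ≡ ∑ f xs * c
∑-*ʳ c f xs = trans (∑-cong xs (λ x → *-comm (f x) c)) (trans (∑-*ˡ c f xs) (*-comm c _))

∑-mono-≤ : {f g : A → ℕ} (xs : List A) → (∀ x → f x ≤ g x) → ∑ f xs ≤ ∑ g xs
∑-mono-≤ []       f≤g = z≤n
∑-mono-≤ (x ∷ xs) f≤g = +-mono-≤ (f≤g x) (∑-mono-≤ xs f≤g)

∑-const : (c : ℕ) (xs : List A) → ∑[ _ ∈ xs ] c ≡ length xs * c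
∑-const c []       = refl
∑-const c (x ∷ xs) = cong (c +_) (∑-const c xs)

∑-1 : (xs : List A) → ∑[ _ ∈ xs ] 1 ≡ length xs
∑-1 xs = trans (∑-const 1 xs) (*-identityʳ _)

∑-0 : (f : A → ℕ) (xs : List A) → (∀ x → f x ≡ 0) → ∑ f xs ≡ 0
∑-0 f xs f≗0 = trans (∑-cong xs f≗0) (trans (∑-const 0 xs) (*-zeroʳ (length xs)))

∑-middle : (f : A → ℕ) (pre : List A) (y : A) (post : List A) →
           ∑ f (pre ++ y ∷ post) ≡ f y + ∑ f (pre ++ post)
∑-middle f []      y post = refl
∑-middle f (x ∷ pre) y post = trans (cong (f x +_) (∑-middle f pre y post)) (x∙yz≈y∙xz (f x) (f y) _)

find-split : {P : Pred A 0ℓ} (P? : Decidable P) (xs : List A) → 0 < ∑[ x ∈ xs ] 𝟙 (P? x) →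
           ∃ λ pre → ∃ λ y → ∃ λ post → xs ≡ pre ++ y ∷ post × P y
find-split P? [] ()
find-split P? (x ∷ xs) pos with P? x
... | yes Px = [] , x , xs , refl , Px
... | no _ with find-split P? xs pos
...   | pre , y , post , refl , Py = x ∷ pre , y , post , refl , Py

∑-map : (h : B → ℕ) (f : A → B) (xs : List A) → ∑ h (map f xs) ≡ ∑ (h ∘ f) xs
∑-map h f []       = refl
∑-map h f (x ∷ xs) = cong (h (f x) +_) (∑-map h f xs)

∑-concatMap : (h : B → ℕ) (f : A → List B) (xs : List A) →
              ∑ h (concatMap f xs) ≡ ∑[ x ∈ xs ] ∑ h (f x)
∑-concatMap h f []       = refl
∑-concatMap h f (x ∷ xs) = trans (∑-++ h (f x) (concatMap f xs)) (cong (∑ h (f x) +_) (∑-concatMap h f xs))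

∑-comm : (F : A → B → ℕ) (xs : List A) (ys : List B) →
         ∑[ x ∈ xs ] ∑[ y ∈ ys ] F x y ≡ ∑[ y ∈ ys ] ∑[ x ∈ xs ] F x y
∑-comm F []       ys = sym (∑-0 _ ys (λ _ → refl))
∑-comm F (x ∷ xs) ys = trans (cong (∑ (F x) ys +_) (∑-comm F xs ys)) (sym (∑-+ (F x) _ ys))

∑-cartesianProduct : (h : A × B → ℕ) (xs : List A) (ys : List B) →
                     ∑ h (cartesianProduct xs ys) ≡ ∑[ x ∈ xs ] ∑[ y ∈ ys ] h (x , y)
∑-cartesianProduct h []       ys = refl
∑-cartesianProduct h (x ∷ xs) ys = begin
  ∑ h (map (x ,_) ys ++ cartesianProduct xs ys)          ≡⟨ ∑-++ h (map (x ,_) ys) _ ⟩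
  ∑ h (map (x ,_) ys) + ∑ h (cartesianProduct xs ys)   ≡⟨ cong₂ _+_ (∑-map h (x ,_) ys) (∑-cartesianProduct h xs ys) ⟩
  ∑[ y ∈ ys ] h (x , y) + ∑[ x ∈ xs ] ∑[ y ∈ ys ] h (x , y) ∎
  where open ≡-Reasoning

∑-allFin-suc : ∀ {n} (f : Fin (suc n) → ℕ) → ∑ f (allFin (suc n)) ≡ f Fin.zero + ∑ (f ∘ Fin.suc) (allFin n)
∑-allFin-suc {n} f = cong (f Fin.zero +_) (trans (cong (∑ f) (sym (ListP.map-tabulate id Fin.suc))) (∑-map f Fin.suc (allFin n)))

length-allFin : ∀ n → length (allFin n) ≡ n
length-allFin n = ListP.length-tabulate id

module Enumeration {A : Set} (_≟_ : DecidableEquality A) where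

  count : A → List A → ℕ
  count x xs = ∑[ y ∈ xs ] 𝟙 (y ≟ x)

  Enumerates : List A → Set
  Enumerates xs = ∀ x → count x xs ≡ 1

  ∑-const-except : (f : A → ℕ) (x : A) (c : ℕ) (xs : List A) → (∀ y → y ≢ x → f y ≡ c) →
             ∑ f xs + count x xs * c ≡ count x xs * f x + length xs * c
  ∑-const-except f x c xs f≡c = begin
    ∑ f xs + count x xs * c                         ≡⟨ cong (∑ f xs +_) (sym (∑-*ʳ c _ xs)) ⟩
    ∑ f xs + ∑[ y ∈ xs ] (𝟙 (y ≟ x) * c)            ≡⟨ sym (∑-+ f _ xs) ⟩
    ∑[ y ∈ xs ] (f y + 𝟙 (y ≟ x) * c)               ≡⟨ ∑-cong xs pointwise ⟩
    ∑[ y ∈ xs ] (𝟙 (y ≟ x) * f x + c)               ≡⟨ ∑-+ _ (λ _ → c) xs ⟩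
    ∑[ y ∈ xs ] (𝟙 (y ≟ x) * f x) + ∑[ _ ∈ xs ] c   ≡⟨ cong₂ _+_ (∑-*ʳ (f x) _ xs) (∑-const c xs) ⟩
    count x xs * f x + length xs * c                ∎
    where
    open ≡-Reasoning
    pointwise : ∀ y → f y + 𝟙 (y ≟ x) * c ≡ 𝟙 (y ≟ x) * f x + c
    pointwise y with y ≟ x
    ... | yes refl = trans (cong (f y +_) (+-identityʳ c)) (cong (_+ c) (sym (+-identityʳ (f y))))
    ... | no y≢x   = trans (+-identityʳ (f y)) (f≡c y y≢x)

  ∑-cong-count : {f g : A → ℕ} (xs : List A) → (∀ x → 0 < count x xs → f x ≡ g x) → ∑ f xs ≡ ∑ g xs
  ∑-cong-count []       f≗g = refl
  ∑-cong-count (y ∷ xs) f≗g = cong₂ _+_ (f≗g y y∈) (∑-cong-count xs (λ x x∈ → f≗g x (≤-trans x∈ (m≤n+m _ _))))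
    where
    y∈ : 0 < count y (y ∷ xs)
    y∈ rewrite 𝟙-yes (y ≟ y) refl = s≤s z≤n

  module _ {xs : List A} (enum : Enumerates xs) where

    ∑-const-except-enum : (f : A → ℕ) (x : A) (c : ℕ) → (∀ y → y ≢ x → f y ≡ c) → ∑ f xs + c ≡ f x + length xs * c
    ∑-const-except-enum f x c f≡c = begin
      ∑ f xs + c                        ≡⟨ cong (∑ f xs +_) (sym (*-identityˡ c)) ⟩
      ∑ f xs + 1 * c                    ≡⟨ cong (λ k → ∑ f xs + k * c) (sym (enum x)) ⟩
      ∑ f xs + count x xs * c           ≡⟨ ∑-const-except f x c xs f≡c ⟩
      count x xs * f x + length xs * c  ≡⟨ cong (λ k → k * f x + length xs * c) (enum x) ⟩
      1 * f x + length xs * c           ≡⟨ cong (_+ length xs * c) (*-identityˡ (f x)) ⟩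
      f x + length xs * c               ∎
      where open ≡-Reasoning

    ∑-point : (f : A → ℕ) (x : A) → (∀ y → y ≢ x → f y ≡ 0) → ∑ f xs ≡ f x
    ∑-point f x f≡0 = +-cancelʳ-≡ 0 _ _ (trans (∑-const-except-enum f x 0 f≡0) (cong (f x +_) (*-zeroʳ (length xs))))

open Enumeration using (Enumerates)

allFin-enumerates : ∀ n → Enumerates FinP._≟_ (allFin n)
allFin-enumerates (suc n) Fin.zero =
  trans (∑-allFin-suc {n} (λ y → 𝟙 (y FinP.≟ Fin.zero))) (cong suc (∑-0 _ (allFin n) (λ _ → refl)))
allFin-enumerates (suc n) (Fin.suc x) = begin
  ∑[ y ∈ allFin (suc n) ] 𝟙 (y FinP.≟ Fin.suc x)   ≡⟨ ∑-allFin-suc {n} (λ y → 𝟙 (y FinP.≟ Fin.suc x)) ⟩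
  ∑[ y ∈ allFin n ] 𝟙 (Fin.suc y FinP.≟ Fin.suc x) ≡⟨ ∑-cong (allFin n) (λ y → 𝟙-cong FinP.suc-injective (cong Fin.suc) _ _) ⟩
  ∑[ y ∈ allFin n ] 𝟙 (y FinP.≟ x)                 ≡⟨ allFin-enumerates n x ⟩
  1                                               ∎
  where open ≡-Reasoning

×-enumerates : (_≟A_ : DecidableEquality A) (_≟B_ : DecidableEquality B) {xs : List A} {ys : List B} →
               Enumerates _≟A_ xs → Enumerates _≟B_ ys →
               Enumerates (ProdP.≡-dec _≟A_ _≟B_) (cartesianProduct xs ys)
×-enumerates _≟A_ _≟B_ {xs} {ys} xs-enum ys-enum (x , y) = begin
  ∑[ p ∈ cartesianProduct xs ys ] 𝟙 (p ≟ (x , y))                  ≡⟨ ∑-cartesianProduct _ xs ys ⟩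
  ∑[ x' ∈ xs ] ∑[ y' ∈ ys ] 𝟙 ((x' , y') ≟ (x , y))               ≡⟨ ∑-cong xs (λ x' → ∑-cong ys (λ y' → 𝟙-pair x' y')) ⟩
  ∑[ x' ∈ xs ] ∑[ y' ∈ ys ] (𝟙 (x' ≟A x) * 𝟙 (y' ≟B y))          ≡⟨ ∑-cong xs (λ x' → ∑-*ˡ (𝟙 (x' ≟A x)) _ ys) ⟩
  ∑[ x' ∈ xs ] (𝟙 (x' ≟A x) * ∑[ y' ∈ ys ] 𝟙 (y' ≟B y))          ≡⟨ ∑-cong xs (λ x' → trans (cong (𝟙 (x' ≟A x) *_) (ys-enum y)) (*-identityʳ _)) ⟩
  ∑[ x' ∈ xs ] 𝟙 (x' ≟A x)                                         ≡⟨ xs-enum x ⟩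
  1                                                                ∎
  where
  open ≡-Reasoning
  _≟_ = ProdP.≡-dec _≟A_ _≟B_
  𝟙-pair : ∀ x' y' → 𝟙 ((x' , y') ≟ (x , y)) ≡ 𝟙 (x' ≟A x) * 𝟙 (y' ≟B y)
  𝟙-pair x' y' = trans (𝟙-cong (λ { refl → refl , refl }) (λ { (refl , refl) → refl }) _ ((x' ≟A x) ×-dec (y' ≟B y)))
                       (𝟙-× (x' ≟A x) (y' ≟B y))

maybe-enumerates : (_≟_ : DecidableEquality A) {xs : List A} → Enumerates _≟_ xs →
                   Enumerates (MaybeP.≡-dec _≟_) (nothing ∷ map just xs)
maybe-enumerates _≟_ {xs} enum nothing = cong suc (trans (∑-map _ just xs) (∑-0 _ xs (λ _ → refl)))
maybe-enumerates _≟_ {xs} enum (just x) =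
  trans (∑-map _ just xs) (trans (∑-cong xs (λ y → 𝟙-cong MaybeP.just-injective (cong just) _ (y ≟ x))) (enum x))

-- Colour-preserving bijections

module ColourMatching {A B C : Set} (_≟A_ : DecidableEquality A) (_≟B_ : DecidableEquality B)
                      (_≟C_ : DecidableEquality C) (colA : A → C) (colB : B → C) where

  private
    module EA = Enumeration _≟A_
    module EB = Enumeration _≟B_

  record ColourBijection (xs : List A) (ys : List B) : Set where
    field
      to        : A → B
      from      : B → A
      from-to   : ∀ x → from (to x) ≡ x
      to-from   : ∀ y → to (from y) ≡ y
      colour-to : ∀ x → colB (to x) ≡ colA x
      ∑-to      : ∀ (h : B → ℕ) → ∑ (h ∘ to) xs ≡ ∑ h ys

  private
    -- The same, restricted to the elements listed once; this is what the induction carries.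
    record Partial (xs : List A) (ys : List B) : Set where
      field
        to        : A → B
        from      : B → A
        to-∈      : ∀ x → EA.count x xs ≡ 1 → EB.count (to x) ys ≡ 1
        from-to   : ∀ x → EA.count x xs ≡ 1 → from (to x) ≡ x
        colour-to : ∀ x → EA.count x xs ≡ 1 → colB (to x) ≡ colA x
        from-∈    : ∀ y → EB.count y ys ≡ 1 → EA.count (from y) xs ≡ 1
        to-from   : ∀ y → EB.count y ys ≡ 1 → to (from y) ≡ y
        ∑-to      : ∀ (h : B → ℕ) → ∑ (h ∘ to) xs ≡ ∑ h ys

    update : {X Y : Set} → DecidableEquality X → (X → Y) → X → Y → X → Y
    update _≟_ f x y z with z ≟ x
    ... | yes _ = y
    ... | no _  = f z

    update-≡ : {X Y : Set} (_≟_ : DecidableEquality X) (f : X → Y) (x : X) (y : Y) → update _≟_ f x y x ≡ y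
    update-≡ _≟_ f x y with x ≟ x
    ... | yes _  = refl
    ... | no x≢x = ⊥-elim (x≢x refl)

    update-≢ : {X Y : Set} (_≟_ : DecidableEquality X) (f : X → Y) {x : X} (y : Y) {z : X} → z ≢ x →
               update _≟_ f x y z ≡ f z
    update-≢ _≟_ f {x} y {z} z≢x with z ≟ x
    ... | yes z≡x = ⊥-elim (z≢x z≡x)
    ... | no _    = refl

    count-cons≡1 : ∀ {X} (_≟_ : DecidableEquality X) {x z : X} {xs} → z ≢ x →
                   Enumeration.count _≟_ z (x ∷ xs) ≡ 1 → Enumeration.count _≟_ z xs ≡ 1
    count-cons≡1 _≟_ {x} {z} z≢x c = trans (cong (_+ _) (sym (𝟙-no (x ≟ z) (z≢x ∘ sym)))) c

    extend : ∀ {x xs pre y post} → EA.count x xs ≡ 0 → EB.count y (pre ++ post) ≡ 0 → colB y ≡ colA x →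
             Partial xs (pre ++ post) → Partial (x ∷ xs) (pre ++ y ∷ post)
    extend {x} {xs} {pre} {y} {post} x∉ y∉ col≡ m = record
      { to = to ; from = from ; to-∈ = to-∈ ; from-to = from-to ; colour-to = colour-to
      ; from-∈ = from-∈ ; to-from = to-from ; ∑-to = ∑-to }
      where
      module M = Partial m
      to   = update _≟A_ M.to x y
      from = update _≟B_ M.from y x

      countB-split : ∀ z → EB.count z (pre ++ y ∷ post) ≡ 𝟙 (y ≟B z) + EB.count z (pre ++ post)
      countB-split z = ∑-middle _ pre y post

      old-to≢y : ∀ {x'} → EA.count x' xs ≡ 1 → M.to x' ≢ y
      old-to≢y c e = 0≢1+n (trans (sym y∉) (trans (cong (λ z → EB.count z (pre ++ post)) (sym e)) (M.to-∈ _ c)))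

      old-from≢x : ∀ {y'} → EB.count y' (pre ++ post) ≡ 1 → M.from y' ≢ x
      old-from≢x c e = 0≢1+n (trans (sym x∉) (trans (cong (λ z → EA.count z xs) (sym e)) (M.from-∈ _ c)))

      to-∈ : ∀ x' → EA.count x' (x ∷ xs) ≡ 1 → EB.count (to x') (pre ++ y ∷ post) ≡ 1
      to-∈ x' c with x' ≟A x
      ... | yes refl = trans (countB-split y) (cong₂ _+_ (𝟙-yes (y ≟B y) refl) y∉)
      ... | no x'≢x  = trans (countB-split _) (cong₂ _+_ (𝟙-no (y ≟B _) (old-to≢y c' ∘ sym)) (M.to-∈ x' c'))
        where c' = count-cons≡1 _≟A_ {x} {x'} {xs} x'≢x c

      from-to : ∀ x' → EA.count x' (x ∷ xs) ≡ 1 → from (to x') ≡ x'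
      from-to x' c with x' ≟A x
      ... | yes refl = update-≡ _≟B_ M.from y x
      ... | no x'≢x  = trans (update-≢ _≟B_ M.from x (old-to≢y c')) (M.from-to x' c')
        where c' = count-cons≡1 _≟A_ {x} {x'} {xs} x'≢x c

      colour-to : ∀ x' → EA.count x' (x ∷ xs) ≡ 1 → colB (to x') ≡ colA x'
      colour-to x' c with x' ≟A x
      ... | yes refl = col≡
      ... | no x'≢x  = M.colour-to x' (count-cons≡1 _≟A_ {x} {x'} {xs} x'≢x c)

      from-∈ : ∀ y' → EB.count y' (pre ++ y ∷ post) ≡ 1 → EA.count (from y') (x ∷ xs) ≡ 1
      from-∈ y' c with y' ≟B y
      ... | yes refl = cong₂ _+_ (𝟙-yes (x ≟A x) refl) x∉
      ... | no y'≢y  = cong₂ _+_ (𝟙-no (x ≟A _) (old-from≢x c' ∘ sym)) (M.from-∈ y' c')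
        where c' = count-cons≡1 _≟B_ {y} {y'} {pre ++ post} y'≢y (trans (sym (∑-middle _ pre y post)) c)

      to-from : ∀ y' → EB.count y' (pre ++ y ∷ post) ≡ 1 → to (from y') ≡ y'
      to-from y' c with y' ≟B y
      ... | yes refl = update-≡ _≟A_ M.to x y
      ... | no y'≢y  = trans (update-≢ _≟A_ M.to y (old-from≢x c')) (M.to-from y' c')
        where c' = count-cons≡1 _≟B_ {y} {y'} {pre ++ post} y'≢y (trans (sym (∑-middle _ pre y post)) c)

      ∑-to : ∀ h → ∑ (h ∘ to) (x ∷ xs) ≡ ∑ h (pre ++ y ∷ post)
      ∑-to h = begin
        h (to x) + ∑ (h ∘ to) xs     ≡⟨ cong₂ _+_ (cong h (update-≡ _≟A_ M.to x y)) (EA.∑-cong-count xs agree) ⟩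
        h y + ∑ (h ∘ M.to) xs        ≡⟨ cong (h y +_) (M.∑-to h) ⟩
        h y + ∑ h (pre ++ post)      ≡⟨ sym (∑-middle h pre y post) ⟩
        ∑ h (pre ++ y ∷ post)        ∎
        where
        open ≡-Reasoning
        agree : ∀ z → 0 < EA.count z xs → h (to z) ≡ h (M.to z)
        agree z z∈ = cong h (update-≢ _≟A_ M.to y (λ { refl → <-irrefl (sym x∉) z∈ }))

    size : {X : Set} → (X → C) → C → List X → ℕ
    size colX c zs = ∑[ z ∈ zs ] 𝟙 (colX z ≟C c)

    size-cons : {X : Set} (colX : X → C) (z : X) (zs : List X) → 0 < size colX (colX z) (z ∷ zs)
    size-cons colX z zs rewrite 𝟙-yes (colX z ≟C colX z) refl = s≤s z≤n

    count≤size : {X : Set} (_≟X_ : DecidableEquality X) (colX : X → C) (z : X) (zs : List X) →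
                 Enumeration.count _≟X_ z zs ≤ size colX (colX z) zs
    count≤size _≟X_ colX z zs = ∑-mono-≤ zs 𝟙≤𝟙
      where
      𝟙≤𝟙 : ∀ z' → 𝟙 (z' ≟X z) ≤ 𝟙 (colX z' ≟C colX z)
      𝟙≤𝟙 z' with z' ≟X z
      ... | yes refl = ≤-reflexive (sym (𝟙-yes (colX z' ≟C colX z') refl))
      ... | no _     = z≤n

    partial : (A → B) → (B → A) → (xs : List A) (ys : List B) →
              (∀ x → EA.count x xs ≤ 1) → (∀ y → EB.count y ys ≤ 1) →
              (∀ c → size colA c xs ≡ size colB c ys) → Partial xs ys
    partial to₀ from₀ [] [] _ _ _ = record
      { to = to₀ ; from = from₀ ; to-∈ = λ _ () ; from-to = λ _ () ; colour-to = λ _ ()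
      ; from-∈ = λ _ () ; to-from = λ _ () ; ∑-to = λ _ → refl }
    partial to₀ from₀ [] (y ∷ ys) _ _ sizes = ⊥-elim (<-irrefl (sizes (colB y)) (size-cons colB y ys))
    partial to₀ from₀ (x ∷ xs) ys dupA dupB sizes
      with find-split (λ y → colB y ≟C colA x) ys (subst (0 <_) (sizes (colA x)) (size-cons colA x xs))
    ... | pre , y , post , refl , col≡ = extend x∉ y∉ col≡ (partial to₀ from₀ xs (pre ++ post) dupA' dupB' sizes')
      where
      dupB-split : ∀ z → 𝟙 (y ≟B z) + EB.count z (pre ++ post) ≤ 1
      dupB-split z = subst (_≤ 1) (∑-middle _ pre y post) (dupB z)

      x∉ : EA.count x xs ≡ 0
      x∉ = n≤0⇒n≡0 (≤-pred (subst (λ k → k + EA.count x xs ≤ 1) (𝟙-yes (x ≟A x) refl) (dupA x)))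

      y∉ : EB.count y (pre ++ post) ≡ 0
      y∉ = n≤0⇒n≡0 (≤-pred (subst (λ k → k + EB.count y (pre ++ post) ≤ 1) (𝟙-yes (y ≟B y) refl) (dupB-split y)))

      dupA' : ∀ z → EA.count z xs ≤ 1
      dupA' z = ≤-trans (m≤n+m _ _) (dupA z)

      dupB' : ∀ z → EB.count z (pre ++ post) ≤ 1
      dupB' z = ≤-trans (m≤n+m _ _) (dupB-split z)

      sizes' : ∀ c → size colA c xs ≡ size colB c (pre ++ post)
      sizes' c = +-cancelˡ-≡ (𝟙 (colA x ≟C c)) _ _
        (trans (sizes c) (trans (∑-middle _ pre y post) (cong (λ k → 𝟙 (k ≟C c) + _) col≡)))

  colourBijection : {xs : List A} {ys : List B} → Enumerates _≟A_ xs → Enumerates _≟B_ ys →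
                    (∀ c → ∑[ x ∈ xs ] 𝟙 (colA x ≟C c) ≡ ∑[ y ∈ ys ] 𝟙 (colB y ≟C c)) → ColourBijection xs ys
  colourBijection {xs} {ys} xs-enum ys-enum sizes = record
    { to = to ; from = from
    ; from-to = λ x → from-to x (xs-enum x) ; to-from = λ y → to-from y (ys-enum y)
    ; colour-to = λ x → colour-to x (xs-enum x) ; ∑-to = ∑-to }
    where
    -- Values off the lists are irrelevant; the colour sizes show that some value exists.
    to₀ : A → B
    to₀ x = proj₁ (proj₂ (find-split (λ y → colB y ≟C colA x) ys
              (subst (0 <_) (sizes (colA x)) (≤-trans (≤-reflexive (sym (xs-enum x))) (count≤size _≟A_ colA x xs)))))
    from₀ : B → A
    from₀ y = proj₁ (proj₂ (find-split (λ x → colA x ≟C colB y) xs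
                (subst (0 <_) (sym (sizes (colB y))) (≤-trans (≤-reflexive (sym (ys-enum y))) (count≤size _≟B_ colB y ys)))))
    open Partial (partial to₀ from₀ xs ys (≤-reflexive ∘ xs-enum) (≤-reflexive ∘ ys-enum) sizes)

-- Colour classes of equitable colourings

∑-allFin≡0 : ∀ {δ} (d : Fin δ → ℕ) → ∑ d (allFin δ) ≡ 0 → ∀ k → d k ≡ 0
∑-allFin≡0 {suc δ} d sum≡0 Fin.zero    = m+n≡0⇒m≡0 (d Fin.zero) (trans (sym (∑-allFin-suc d)) sum≡0)
∑-allFin≡0 {suc δ} d sum≡0 (Fin.suc k) =
  ∑-allFin≡0 (d ∘ Fin.suc) (m+n≡0⇒n≡0 (d Fin.zero) (trans (sym (∑-allFin-suc d)) sum≡0)) k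

m+n≡1⇒m≡0∧n≡1⊎m≡1∧n≡0 : ∀ m n → m + n ≡ 1 → (m ≡ 0 × n ≡ 1) ⊎ (m ≡ 1 × n ≡ 0)
m+n≡1⇒m≡0∧n≡1⊎m≡1∧n≡0 zero       n    m+n≡1 = inj₁ (refl , m+n≡1)
m+n≡1⇒m≡0∧n≡1⊎m≡1∧n≡0 (suc zero) zero _     = inj₂ (refl , refl)

∑-allFin≡1 : ∀ {δ} (d : Fin δ → ℕ) → ∑ d (allFin δ) ≡ 1 → ∃[ κ ] ∀ k → d k ≡ 𝟙 (κ FinP.≟ k)
∑-allFin≡1 {suc δ} d sum≡1
  with m+n≡1⇒m≡0∧n≡1⊎m≡1∧n≡0 (d Fin.zero) _ (trans (sym (∑-allFin-suc d)) sum≡1)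
... | inj₂ (d₀≡1 , rest≡0) = Fin.zero , λ { Fin.zero → d₀≡1 ; (Fin.suc k) → ∑-allFin≡0 (d ∘ Fin.suc) rest≡0 k }
... | inj₁ (d₀≡0 , rest≡1) with ∑-allFin≡1 (d ∘ Fin.suc) rest≡1
...   | κ , d∘suc≡ = Fin.suc κ , λ
  { Fin.zero    → d₀≡0
  ; (Fin.suc k) → trans (d∘suc≡ k) (𝟙-cong (cong Fin.suc) FinP.suc-injective _ _) }

∑-colourCount : ∀ {δ} (col : A → Fin δ) (xs : List A) → ∑ (colourCount col xs) (allFin δ) ≡ length xs
∑-colourCount {δ = δ} col xs = begin
  ∑[ k ∈ allFin δ ] colourCount col xs k               ≡⟨ ∑-cong (allFin δ) (λ k → length-filter≡∑𝟙 (λ x → col x FinP.≟ k) xs) ⟩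
  ∑[ k ∈ allFin δ ] ∑[ x ∈ xs ] 𝟙 (col x FinP.≟ k)     ≡⟨ ∑-comm (λ k x → 𝟙 (col x FinP.≟ k)) (allFin δ) xs ⟩
  ∑[ x ∈ xs ] ∑[ k ∈ allFin δ ] 𝟙 (col x FinP.≟ k)     ≡⟨ ∑-cong xs (λ x → trans (∑-cong (allFin δ) (λ k → 𝟙-cong sym sym _ _)) (allFin-enumerates δ (col x))) ⟩
  ∑[ _ ∈ xs ] 1                                        ≡⟨ ∑-1 xs ⟩
  length xs                                            ∎
  where open ≡-Reasoning

module _ {δ : ℕ} (n : Fin δ → ℕ) (balanced : ∀ k k' → n k ≤ suc (n k')) where

  balanced-lower : ∀ {g} → δ * g ≤ ∑ n (allFin δ) → ∀ k → g ≤ n k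
  balanced-lower {g} δg≤∑ k = ≤-pred (*-cancelˡ-< δ g (suc (n k)) (begin-strict
    δ * g                                          ≤⟨ δg≤∑ ⟩
    ∑ n (allFin δ)                                 <⟨ ∑<∑+1 ⟩
    ∑ n (allFin δ) + ∑[ k' ∈ allFin δ ] 𝟙 (k' FinP.≟ k) ≡⟨ sym (∑-+ n _ (allFin δ)) ⟩
    ∑[ k' ∈ allFin δ ] (n k' + 𝟙 (k' FinP.≟ k))     ≤⟨ ∑-mono-≤ (allFin δ) pointwise ⟩
    ∑[ _ ∈ allFin δ ] suc (n k)                    ≡⟨ trans (∑-const _ (allFin δ)) (cong (_* suc (n k)) (length-allFin δ)) ⟩
    δ * suc (n k)                                  ∎))
    where
    open ≤-Reasoning
    ∑<∑+1 : ∑ n (allFin δ) < ∑ n (allFin δ) + ∑[ k' ∈ allFin δ ] 𝟙 (k' FinP.≟ k)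
    ∑<∑+1 = subst (∑ n (allFin δ) <_) (cong (∑ n (allFin δ) +_) (sym (allFin-enumerates δ k)) ) (≤-reflexive (+-comm 1 _))
    pointwise : ∀ k' → n k' + 𝟙 (k' FinP.≟ k) ≤ suc (n k)
    pointwise k' with k' FinP.≟ k
    ... | yes refl = ≤-reflexive (+-comm (n k') 1)
    ... | no _     = ≤-trans (≤-reflexive (+-identityʳ (n k'))) (balanced k' k)

  balanced-excess : ∀ {g e} → ∑ n (allFin δ) ≡ δ * g + e →
                    (∀ k → n k ≡ g + (n k ∸ g)) × ∑[ k ∈ allFin δ ] (n k ∸ g) ≡ e
  balanced-excess {g} {e} ∑≡ = n≡ , +-cancelˡ-≡ (δ * g) _ _ (begin
    δ * g + ∑[ k ∈ allFin δ ] (n k ∸ g)            ≡⟨ cong (_+ ∑[ k ∈ allFin δ ] (n k ∸ g)) (trans (cong (_* g) (sym (length-allFin δ))) (sym (∑-const g (allFin δ)))) ⟩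
    ∑[ _ ∈ allFin δ ] g + ∑[ k ∈ allFin δ ] (n k ∸ g) ≡⟨ sym (∑-+ _ _ (allFin δ)) ⟩
    ∑[ k ∈ allFin δ ] (g + (n k ∸ g))              ≡⟨ sym (∑-cong (allFin δ) n≡) ⟩
    ∑ n (allFin δ)                                 ≡⟨ ∑≡ ⟩
    δ * g + e                                      ∎)
    where
    open ≡-Reasoning
    n≡ : ∀ k → n k ≡ g + (n k ∸ g)
    n≡ k = sym (m+[n∸m]≡n (balanced-lower (≤-trans (m≤m+n (δ * g) e) (≤-reflexive (sym ∑≡))) k))

  balanced-uniform : ∀ {g} → ∑ n (allFin δ) ≡ δ * g → ∀ k → n k ≡ g
  balanced-uniform {g} ∑≡ k = trans (proj₁ excess k) (trans (cong (g +_) (∑-allFin≡0 _ (proj₂ excess) k)) (+-identityʳ g))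
    where excess = balanced-excess {g} {0} (trans ∑≡ (sym (+-identityʳ _)))

  balanced-one-above : ∀ {g} → ∑ n (allFin δ) ≡ δ * g + 1 → ∃[ κ ] ∀ k → n k ≡ 𝟙 (κ FinP.≟ k) + g
  balanced-one-above {g} ∑≡ with balanced-excess ∑≡
  ... | n≡ , ∑excess≡1 with ∑-allFin≡1 _ ∑excess≡1
  ...   | κ , excess≡ = κ , λ k → trans (n≡ k) (trans (cong (g +_) (excess≡ k)) (+-comm g _))

length-filter-++ : {P : Pred A 0ℓ} (P? : Decidable P) (xs ys : List A) →
                   length (filter P? (xs ++ ys)) ≡ length (filter P? xs) + length (filter P? ys)
length-filter-++ P? xs ys = trans (cong length (ListP.filter-++ P? xs ys)) (ListP.length-++ (filter P? xs))

length-filter-concatMap : {P : Pred B 0ℓ} (P? : Decidable P) (f : A → List B) (xs : List A) →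
                          length (filter P? (concatMap f xs)) ≡ ∑[ x ∈ xs ] length (filter P? (f x))
length-filter-concatMap P? f xs =
  trans (length-filter≡∑𝟙 P? (concatMap f xs)) (trans (∑-concatMap _ f xs) (∑-cong xs (λ x → sym (length-filter≡∑𝟙 P? (f x)))))

All-concatMap⁺ : {Q : Pred B 0ℓ} (f : A → List B) (xs : List A) → (∀ x → All Q (f x)) → All Q (concatMap f xs)
All-concatMap⁺ f xs all-f = AllP.concat⁺ (AllP.map⁺ (All.universal all-f xs))

All-concatMap⁻ : {Q : Pred B 0ℓ} (f : A → List B) (xs : List A) → All Q (concatMap f xs) → ∀ {x} → x ∈ xs → All Q (f x)
All-concatMap⁻ f xs all-cm = All.lookup (AllP.map⁻ (AllP.concat⁻ all-cm))

module Incidence {P : Set} (_≟_ : DecidableEquality P) where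

  open Counting _≟_

  module _ {xs : List P} (enum : Enumerates _≟_ xs) where

    ∑-∈T : (B : Triple P) → ∑[ y ∈ xs ] 𝟙 (y ∈T? B) ≡ 3
    ∑-∈T B@(tri a b c a≢b a≢c b≢c) = begin
      ∑[ y ∈ xs ] 𝟙 (y ∈T? B)                                  ≡⟨ ∑-cong xs 𝟙-∈T ⟩
      ∑[ y ∈ xs ] (𝟙 (y ≟ a) + (𝟙 (y ≟ b) + 𝟙 (y ≟ c)))        ≡⟨ trans (∑-+ _ _ xs) (cong (count a xs +_) (∑-+ (λ y → 𝟙 (y ≟ b)) _ xs)) ⟩
      count a xs + (count b xs + count c xs)                  ≡⟨ cong₂ _+_ (enum a) (cong₂ _+_ (enum b) (enum c)) ⟩
      3                                                       ∎
      where
      open ≡-Reasoning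
      open Enumeration _≟_ using (count)
      𝟙-∈T : ∀ y → 𝟙 (y ∈T? B) ≡ 𝟙 (y ≟ a) + (𝟙 (y ≟ b) + 𝟙 (y ≟ c))
      𝟙-∈T y = trans (𝟙-⊎ (y ≟ a) _ (λ { (refl , inj₁ a≡b) → a≢b a≡b ; (refl , inj₂ a≡c) → a≢c a≡c }))
                     (cong (𝟙 (y ≟ a) +_) (𝟙-⊎ (y ≟ b) (y ≟ c) (λ { (refl , b≡c) → b≢c b≡c })))

    ∑-countPair : ∀ x bs → ∑[ y ∈ xs ] countPair x y bs ≡ 3 * countPt x bs
    ∑-countPair x bs = begin
      ∑[ y ∈ xs ] countPair x y bs                                ≡⟨ ∑-cong xs (λ y → length-filter≡∑𝟙 (λ B → (x ∈T? B) ×-dec (y ∈T? B)) bs) ⟩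
      ∑[ y ∈ xs ] ∑[ B ∈ bs ] 𝟙 ((x ∈T? B) ×-dec (y ∈T? B))      ≡⟨ ∑-cong xs (λ y → ∑-cong bs (λ B → 𝟙-× (x ∈T? B) (y ∈T? B))) ⟩
      ∑[ y ∈ xs ] ∑[ B ∈ bs ] (𝟙 (x ∈T? B) * 𝟙 (y ∈T? B))        ≡⟨ ∑-comm _ xs bs ⟩
      ∑[ B ∈ bs ] ∑[ y ∈ xs ] (𝟙 (x ∈T? B) * 𝟙 (y ∈T? B))        ≡⟨ ∑-cong bs (λ B → ∑-*ˡ (𝟙 (x ∈T? B)) _ xs) ⟩
      ∑[ B ∈ bs ] (𝟙 (x ∈T? B) * ∑[ y ∈ xs ] 𝟙 (y ∈T? B))        ≡⟨ ∑-cong bs (λ B → trans (cong (𝟙 (x ∈T? B) *_) (∑-∈T B)) (*-comm (𝟙 (x ∈T? B)) 3)) ⟩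
      ∑[ B ∈ bs ] (3 * 𝟙 (x ∈T? B))                              ≡⟨ ∑-*ˡ 3 _ bs ⟩
      3 * ∑[ B ∈ bs ] 𝟙 (x ∈T? B)                                ≡⟨ cong (3 *_) (sym (length-filter≡∑𝟙 _ bs)) ⟩
      3 * countPt x bs                                           ∎
      where open ≡-Reasoning

  countPair-diag : ∀ x bs → countPair x x bs ≡ countPt x bs
  countPair-diag x bs = trans (length-filter≡∑𝟙 _ bs)
    (trans (∑-cong bs (λ B → 𝟙-cong proj₁ (λ x∈B → x∈B , x∈B) _ _)) (sym (length-filter≡∑𝟙 (x ∈T?_) bs)))

mapTriple : (f : A → B) → (∀ {x y} → f x ≡ f y → x ≡ y) → Triple A → Triple B
mapTriple f f-inj B = tri (f (a B)) (f (b B)) (f (c B)) (a≢b B ∘ f-inj) (a≢c B ∘ f-inj) (b≢c B ∘ f-inj)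

Proper-relabel : ∀ {δ} (f : A → B) (f-inj : ∀ {x y} → f x ≡ f y → x ≡ y) {colA : A → Fin δ} {colB : B → Fin δ} →
                 (∀ x → colB (f x) ≡ colA x) → ∀ {bs} → Proper bs colA → Proper (map (mapTriple f f-inj) bs) colB
Proper-relabel f f-inj colB∘f≡colA proper = AllP.map⁺ (All.map (λ ¬mono (e₁ , e₂) → ¬mono (same e₁ , same e₂)) proper)
  where
  same : ∀ {x y} → _ → _
  same {x} {y} e = trans (sym (colB∘f≡colA x)) (trans e (colB∘f≡colA y))

module Relabel {A P : Set} (_≟A_ : DecidableEquality A) (_≟P_ : DecidableEquality P)
               (ψ : A → P) (ρ : P → Maybe A)
               (ρ∘ψ : ∀ x → ρ (ψ x) ≡ just x) (ψ∘ρ : ∀ {p x} → ρ p ≡ just x → ψ x ≡ p) where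

  private
    module CA = Counting _≟A_
    module CP = Counting _≟P_

  ψ-injective : ∀ {x y} → ψ x ≡ ψ y → x ≡ y
  ψ-injective {x} {y} ψx≡ψy = MaybeP.just-injective (trans (sym (ρ∘ψ x)) (trans (cong ρ ψx≡ψy) (ρ∘ψ y)))

  relabel : Triple A → Triple P
  relabel = mapTriple ψ ψ-injective

  ∈T-relabel : ∀ {p x} → ρ p ≡ just x → ∀ B → (p ∈T relabel B → x ∈T B) × (x ∈T B → p ∈T relabel B)
  ∈T-relabel {p} {x} ρp≡x B = to , from
    where
    preimage : ∀ {y} → p ≡ ψ y → x ≡ y
    preimage {y} refl = MaybeP.just-injective (trans (sym ρp≡x) (ρ∘ψ y))
    to : p ∈T relabel B → x ∈T B
    to (inj₁ e)        = inj₁ (preimage e)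
    to (inj₂ (inj₁ e)) = inj₂ (inj₁ (preimage e))
    to (inj₂ (inj₂ e)) = inj₂ (inj₂ (preimage e))
    p≡ψx : p ≡ ψ x
    p≡ψx = sym (ψ∘ρ ρp≡x)
    from : x ∈T B → p ∈T relabel B
    from (inj₁ refl)        = inj₁ p≡ψx
    from (inj₂ (inj₁ refl)) = inj₂ (inj₁ p≡ψx)
    from (inj₂ (inj₂ refl)) = inj₂ (inj₂ p≡ψx)

  ∉T-relabel : ∀ {p} → ρ p ≡ nothing → ∀ B → ¬ (p ∈T relabel B)
  ∉T-relabel {p} ρp≡nothing B p∈ = outside-image (case p∈)
    where
    outside-image : ∃[ y ] p ≡ ψ y → ⊥
    outside-image (y , refl) with trans (sym ρp≡nothing) (ρ∘ψ y)
    ... | ()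
    case : p ∈T relabel B → ∃[ y ] p ≡ ψ y
    case (inj₁ e)        = _ , e
    case (inj₂ (inj₁ e)) = _ , e
    case (inj₂ (inj₂ e)) = _ , e

  countPt-relabel : ∀ {p x} → ρ p ≡ just x → ∀ bs → CP.countPt p (map relabel bs) ≡ CA.countPt x bs
  countPt-relabel {p} {x} ρp≡x bs = begin
    CP.countPt p (map relabel bs)          ≡⟨ trans (length-filter≡∑𝟙 _ (map relabel bs)) (∑-map _ relabel bs) ⟩
    ∑[ B ∈ bs ] 𝟙 (p CP.∈T? relabel B)     ≡⟨ ∑-cong bs (λ B → 𝟙-cong (proj₁ (∈T-relabel ρp≡x B)) (proj₂ (∈T-relabel ρp≡x B)) _ _) ⟩
    ∑[ B ∈ bs ] 𝟙 (x CA.∈T? B)             ≡⟨ sym (length-filter≡∑𝟙 _ bs) ⟩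
    CA.countPt x bs                        ∎
    where open ≡-Reasoning

  countPt-relabel-∉ : ∀ {p} → ρ p ≡ nothing → ∀ bs → CP.countPt p (map relabel bs) ≡ 0
  countPt-relabel-∉ ρp≡nothing bs =
    trans (length-filter≡∑𝟙 _ (map relabel bs)) (trans (∑-map _ relabel bs) (∑-0 _ bs (λ B → 𝟙-no _ (∉T-relabel ρp≡nothing B))))

  countPair-relabel : ∀ {p q x y} → ρ p ≡ just x → ρ q ≡ just y → ∀ bs →
                      CP.countPair p q (map relabel bs) ≡ CA.countPair x y bs
  countPair-relabel {p} {q} {x} {y} ρp≡x ρq≡y bs = begin
    CP.countPair p q (map relabel bs)                           ≡⟨ trans (length-filter≡∑𝟙 _ (map relabel bs)) (∑-map _ relabel bs) ⟩
    ∑[ B ∈ bs ] 𝟙 ((p CP.∈T? relabel B) ×-dec (q CP.∈T? relabel B)) ≡⟨ ∑-cong bs (λ B → 𝟙-cong (to B) (from B) _ _) ⟩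
    ∑[ B ∈ bs ] 𝟙 ((x CA.∈T? B) ×-dec (y CA.∈T? B))             ≡⟨ sym (length-filter≡∑𝟙 _ bs) ⟩
    CA.countPair x y bs                                         ∎
    where
    open ≡-Reasoning
    to : ∀ B → p ∈T relabel B × q ∈T relabel B → x ∈T B × y ∈T B
    to B (p∈ , q∈) = proj₁ (∈T-relabel ρp≡x B) p∈ , proj₁ (∈T-relabel ρq≡y B) q∈
    from : ∀ B → x ∈T B × y ∈T B → p ∈T relabel B × q ∈T relabel B
    from B (x∈ , y∈) = proj₂ (∈T-relabel ρp≡x B) x∈ , proj₂ (∈T-relabel ρq≡y B) y∈

  countPair-relabel-∉ˡ : ∀ {p} q → ρ p ≡ nothing → ∀ bs → CP.countPair p q (map relabel bs) ≡ 0
  countPair-relabel-∉ˡ q ρp≡nothing bs = trans (length-filter≡∑𝟙 _ (map relabel bs))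
    (trans (∑-map _ relabel bs) (∑-0 _ bs (λ B → 𝟙-no _ (∉T-relabel ρp≡nothing B ∘ proj₁))))

  countPair-relabel-∉ʳ : ∀ p {q} → ρ q ≡ nothing → ∀ bs → CP.countPair p q (map relabel bs) ≡ 0
  countPair-relabel-∉ʳ p ρq≡nothing bs = trans (length-filter≡∑𝟙 _ (map relabel bs))
    (trans (∑-map _ relabel bs) (∑-0 _ bs (λ B → 𝟙-no _ (∉T-relabel ρq≡nothing B ∘ proj₂))))

-- Replication numbers

-- Through a point x, ∑_y countPair x y is 3 r (each block counts x too) and r + n (Steiner).
KTS-replication : ∀ {n} (K : KTS (n + 1)) → 2 * KTS.r K ≡ n
KTS-replication {n} K = +-cancelʳ-≡ (r + 1) (2 * r) n (begin
  2 * r + (r + 1)                                        ≡⟨ solve-3r+1 r ⟩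
  3 * r + 1                                              ≡⟨ cong (λ d → 3 * d + 1) (sym deg≡r) ⟩
  3 * countPt x blocks + 1                               ≡⟨ cong (_+ 1) (sym (∑-countPair {allFin (n + 1)} (allFin-enumerates (n + 1)) x blocks)) ⟩
  ∑[ y ∈ allFin (n + 1) ] countPair x y blocks + 1       ≡⟨ ∑-const-except-enum {allFin (n + 1)} (allFin-enumerates (n + 1)) _ x 1
                                                              (λ y y≢x → steiner x y (y≢x ∘ sym)) ⟩
  countPair x x blocks + length (allFin (n + 1)) * 1     ≡⟨ cong₂ (λ d l → d + l * 1) (trans (countPair-diag x blocks) deg≡r) (length-allFin (n + 1)) ⟩
  r + (n + 1) * 1                                        ≡⟨ solve-r+n r n ⟩
  n + (r + 1)                                            ∎)
  where
  open ≡-Reasoning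
  open KTS K
  open Counting (FinP._≟_ {n + 1})
  open Incidence (FinP._≟_ {n + 1})
  open Enumeration (FinP._≟_ {n + 1}) using (∑-const-except-enum)
  x : Fin (n + 1)
  x = Fin.fromℕ< (m<m+n n (s≤s z≤n))
  deg≡r : countPt x blocks ≡ r
  deg≡r = trans (length-filter-concatMap _ classes (allFin r))
                (trans (∑-cong (allFin r) (λ k → parallel k x)) (trans (∑-1 (allFin r)) (length-allFin r)))
  solve-3r+1 : ∀ r → 2 * r + (r + 1) ≡ 3 * r + 1
  solve-3r+1 = solve-∀
  solve-r+n : ∀ r n → r + (n + 1) * 1 ≡ n + (r + 1)
  solve-r+n = solve-∀

module FrameCounting {m u : ℕ} (F : KirkmanFrame m u) where

  open KirkmanFrame F
  open Counting (_≟F_ {m} {u})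
  open Incidence (_≟F_ {m} {u})
  open Enumeration (FinP._≟_ {u}) using (∑-const-except-enum)
  open Enumeration (FinP._≟_ {m}) using (∑-point)

  holeCount : Fin u → ℕ
  holeCount i = ∑[ j ∈ allFin r ] 𝟙 (hole j FinP.≟ i)

  ∑-holeCount : ∑ holeCount (allFin u) ≡ r
  ∑-holeCount = begin
    ∑[ i ∈ allFin u ] ∑[ j ∈ allFin r ] 𝟙 (hole j FinP.≟ i)  ≡⟨ ∑-comm _ (allFin u) (allFin r) ⟩
    ∑[ j ∈ allFin r ] ∑[ i ∈ allFin u ] 𝟙 (hole j FinP.≟ i)  ≡⟨ ∑-cong (allFin r) (λ j → trans (∑-cong (allFin u) (λ i → 𝟙-cong sym sym _ _))
                                                                                         (allFin-enumerates u (hole j))) ⟩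
    ∑[ _ ∈ allFin r ] 1                                     ≡⟨ trans (∑-1 (allFin r)) (length-allFin r) ⟩
    r                                                       ∎
    where open ≡-Reasoning

  countPt+holeCount : ∀ x → countPt x blocks + holeCount (proj₁ x) ≡ r
  countPt+holeCount x = begin
    countPt x blocks + holeCount (proj₁ x)                              ≡⟨ cong (_+ holeCount (proj₁ x)) (length-filter-concatMap _ classes (allFin r)) ⟩
    ∑[ j ∈ allFin r ] countPt x (classes j) + holeCount (proj₁ x)       ≡⟨ sym (∑-+ _ _ (allFin r)) ⟩
    ∑[ j ∈ allFin r ] (countPt x (classes j) + 𝟙 (hole j FinP.≟ proj₁ x)) ≡⟨ ∑-cong (allFin r) covered-once ⟩
    ∑[ _ ∈ allFin r ] 1                                                 ≡⟨ trans (∑-1 (allFin r)) (length-allFin r) ⟩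
    r                                                                   ∎
    where
    open ≡-Reasoning
    covered-once : ∀ j → countPt x (classes j) + 𝟙 (hole j FinP.≟ proj₁ x) ≡ 1
    covered-once j with hole j FinP.≟ proj₁ x
    ... | yes hole≡ = cong (_+ 1) (proj₁ (partialParallel j x) (sym hole≡))
    ... | no hole≢  = trans (+-identityʳ _) (proj₂ (partialParallel j x) (hole≢ ∘ sym))

  ∈T-group-injective : ∀ {B : Triple (FPt m u)} → proj₁ (a B) ≢ proj₁ (b B) × proj₁ (a B) ≢ proj₁ (c B) × proj₁ (b B) ≢ proj₁ (c B) →
                       ∀ {p q} → p ∈T B → q ∈T B → proj₁ p ≡ proj₁ q → p ≡ q
  ∈T-group-injective _              (inj₁ refl)        (inj₁ refl)        _ = refl
  ∈T-group-injective (ab , ac , bc) (inj₁ refl)        (inj₂ (inj₁ refl)) e = ⊥-elim (ab e)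
  ∈T-group-injective (ab , ac , bc) (inj₁ refl)        (inj₂ (inj₂ refl)) e = ⊥-elim (ac e)
  ∈T-group-injective (ab , ac , bc) (inj₂ (inj₁ refl)) (inj₁ refl)        e = ⊥-elim (ab (sym e))
  ∈T-group-injective _              (inj₂ (inj₁ refl)) (inj₂ (inj₁ refl)) _ = refl
  ∈T-group-injective (ab , ac , bc) (inj₂ (inj₁ refl)) (inj₂ (inj₂ refl)) e = ⊥-elim (bc e)
  ∈T-group-injective (ab , ac , bc) (inj₂ (inj₂ refl)) (inj₁ refl)        e = ⊥-elim (ac (sym e))
  ∈T-group-injective (ab , ac , bc) (inj₂ (inj₂ refl)) (inj₂ (inj₁ refl)) e = ⊥-elim (bc (sym e))
  ∈T-group-injective _              (inj₂ (inj₂ refl)) (inj₂ (inj₂ refl)) _ = refl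

  countPair-sameGroup : ∀ p q → proj₁ p ≡ proj₁ q → p ≢ q → countPair p q blocks ≡ 0
  countPair-sameGroup p q same p≢q = cong length (ListP.filter-none _
    (All.map (λ {B} t (p∈ , q∈) → p≢q (∈T-group-injective {B} t p∈ q∈ same)) transversal))

  2*countPt+m : ∀ x → 2 * countPt x blocks + m ≡ u * m
  2*countPt+m x@(i , j) = +-cancelˡ-≡ deg _ _ (begin
    deg + (2 * deg + m)                                ≡⟨ solve-3d+m deg m ⟩
    3 * deg + m                                        ≡⟨ cong (_+ m) (sym (∑-countPair {points} points-enum x blocks)) ⟩
    ∑[ y ∈ points ] countPair x y blocks + m           ≡⟨ cong (_+ m) (∑-cartesianProduct _ (allFin u) (allFin m)) ⟩
    ∑ pairsWithGroup (allFin u) + m                    ≡⟨ ∑-const-except-enum {allFin u} (allFin-enumerates u) pairsWithGroup i m other-group ⟩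
    pairsWithGroup i + length (allFin u) * m           ≡⟨ cong₂ (λ d l → d + l * m) own-group (length-allFin u) ⟩
    deg + u * m                                        ∎)
    where
    open ≡-Reasoning
    deg = countPt x blocks
    points = cartesianProduct (allFin u) (allFin m)
    points-enum : Enumerates _≟F_ points
    points-enum = ×-enumerates FinP._≟_ FinP._≟_ {allFin u} {allFin m} (allFin-enumerates u) (allFin-enumerates m)
    pairsWithGroup : Fin u → ℕ
    pairsWithGroup i' = ∑[ j' ∈ allFin m ] countPair x (i' , j') blocks
    own-group : pairsWithGroup i ≡ deg
    own-group = trans (∑-point {allFin m} (allFin-enumerates m) _ j
                         (λ j' j'≢j → countPair-sameGroup x (i , j') refl (λ e → j'≢j (sym (cong proj₂ e)))))
                      (countPair-diag x blocks)
    other-group : ∀ i' → i' ≢ i → pairsWithGroup i' ≡ m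
    other-group i' i'≢i = trans (∑-cong (allFin m) (λ j' → gdd x (i' , j') (i'≢i ∘ sym)))
                                (trans (∑-1 (allFin m)) (length-allFin m))
    solve-3d+m : ∀ d m → d + (2 * d + m) ≡ 3 * d + m
    solve-3d+m = solve-∀

  2*holeCount+u*m : ∀ x → 2 * holeCount (proj₁ x) + u * m ≡ 2 * r + m
  2*holeCount+u*m x = begin
    2 * h + u * m                ≡⟨ cong (2 * h +_) (sym (2*countPt+m x)) ⟩
    2 * h + (2 * deg + m)        ≡⟨ solve-2[d+h]+m h deg m ⟩
    2 * (deg + h) + m            ≡⟨ cong (λ t → 2 * t + m) (countPt+holeCount x) ⟩
    2 * r + m                    ∎
    where
    open ≡-Reasoning
    h = holeCount (proj₁ x)
    deg = countPt x blocks
    solve-2[d+h]+m : ∀ h d m → 2 * h + (2 * d + m) ≡ 2 * (d + h) + m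
    solve-2[d+h]+m = solve-∀

holeCount-uniform : ∀ {m v} (F : KirkmanFrame (suc m) (suc (suc v))) i → 2 * FrameCounting.holeCount F i ≡ suc m
holeCount-uniform {m} {v} F i = +-cancelʳ-≡ (u * m') _ _ (begin
  2 * holeCount i + u * m'  ≡⟨ 2*holeCount+u*m (i , Fin.zero) ⟩
  2 * r + m'                ≡⟨ cong (_+ m') 2r≡u*m ⟩
  u * m' + m'               ≡⟨ +-comm (u * m') m' ⟩
  m' + u * m'               ∎)
  where
  open ≡-Reasoning
  open KirkmanFrame F using (r)
  open FrameCounting F
  m' = suc m
  u = suc (suc v)
  summed : 2 * r + u * (u * m') ≡ u * (2 * r + m')
  summed = begin
    2 * r + u * (u * m')                                      ≡⟨ cong₂ (λ s l → 2 * s + l * (u * m')) (sym ∑-holeCount) (sym (length-allFin u)) ⟩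
    2 * ∑ holeCount (allFin u) + length (allFin u) * (u * m') ≡⟨ sym (cong₂ _+_ (∑-*ˡ 2 holeCount (allFin u)) (∑-const (u * m') (allFin u))) ⟩
    ∑[ i ∈ allFin u ] (2 * holeCount i) + ∑[ _ ∈ allFin u ] (u * m') ≡⟨ sym (∑-+ (λ i → 2 * holeCount i) (λ _ → u * m') (allFin u)) ⟩
    ∑[ i ∈ allFin u ] (2 * holeCount i + u * m')              ≡⟨ ∑-cong (allFin u) (λ i → 2*holeCount+u*m (i , Fin.zero)) ⟩
    ∑[ _ ∈ allFin u ] (2 * r + m')                            ≡⟨ trans (∑-const (2 * r + m') (allFin u)) (cong (_* (2 * r + m')) (length-allFin u)) ⟩
    u * (2 * r + m')                                          ∎
  -- cancel u - 1 = suc v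
  2r≡u*m : 2 * r ≡ u * m'
  2r≡u*m = *-cancelˡ-≡ (2 * r) (u * m') (suc v) (+-cancelˡ-≡ (2 * r + u * m') _ _ (begin
    2 * r + u * m' + suc v * (2 * r)   ≡⟨ solve-left (2 * r) v m' ⟩
    u * (2 * r + m')                   ≡⟨ sym summed ⟩
    2 * r + u * (u * m')               ≡⟨ solve-right (2 * r) v m' ⟩
    2 * r + u * m' + suc v * (u * m')  ∎))
    where
    solve-left : ∀ t v m → t + suc (suc v) * m + suc v * t ≡ suc (suc v) * (t + m)
    solve-left = solve-∀
    solve-right : ∀ t v m → t + suc (suc v) * (suc (suc v) * m) ≡ t + suc (suc v) * m + suc v * (suc (suc v) * m)
    solve-right = solve-∀

-- Filling the groups of the frame

module Construction
  {g' v : ℕ}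
  (F : KirkmanFrame (4 * suc g') (suc (suc v)))
  (col : FPt (4 * suc g') (suc (suc v)) → Fin 4)
  (col-proper : Proper (KirkmanFrame.blocks F) col)
  (col-equitable : ∀ i → EquitableOn col (groupPts i))
  (K : KTS (4 * suc g' + 1))
  (K-not-3-colourable : ∀ δ → δ < 4 → ¬ Colourable (KTS.blocks K) δ)
  (colK : Fin (4 * suc g' + 1) → Fin 4)
  (colK-proper : Proper (KTS.blocks K) colK)
  (colK-equitable : EquitableOn colK (allFin (4 * suc g' + 1)))
  where

  g = suc g'
  m = 4 * g
  u = suc (suc v)
  n = m + 1
  module F = KirkmanFrame F
  module K = KTS K

  κ-spec : ∃[ κ ] ∀ k → colourCount colK (allFin n) k ≡ 𝟙 (κ FinP.≟ k) + g
  κ-spec = balanced-one-above (colourCount colK (allFin n)) colK-equitable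
             (trans (∑-colourCount colK (allFin n)) (length-allFin n))

  κ : Fin 4
  κ = proj₁ κ-spec

  group-colour-sizes : ∀ i k → colourCount col (groupPts i) k ≡ g
  group-colour-sizes i = balanced-uniform (colourCount col (groupPts i)) (col-equitable i)
    (trans (∑-colourCount col (groupPts i)) (trans (ListP.length-map _ (allFin m)) (length-allFin m)))

  -- nothing is the new point ∞.
  P : Set
  P = Maybe (FPt m u)

  _≟P_ : DecidableEquality P
  _≟P_ = MaybeP.≡-dec _≟F_

  colP : P → Fin 4
  colP nothing  = κ
  colP (just p) = col p

  inGroup : Fin u → Maybe (Fin m) → P
  inGroup i = Data.Maybe.map (i ,_)

  localise : Fin u → P → Maybe (Maybe (Fin m))
  localise i nothing = just nothing
  localise i (just (i' , j)) with i' FinP.≟ i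
  ... | yes _ = just (just j)
  ... | no _  = nothing

  localise-inGroup : ∀ i w → localise i (inGroup i w) ≡ just w
  localise-inGroup i nothing  = refl
  localise-inGroup i (just j) with i FinP.≟ i
  ... | yes _  = refl
  ... | no i≢i = ⊥-elim (i≢i refl)

  inGroup-localise : ∀ i {p w} → localise i p ≡ just w → inGroup i w ≡ p
  inGroup-localise i {nothing}       refl = refl
  inGroup-localise i {just (i' , j)} eq with i' FinP.≟ i
  inGroup-localise i {just (i' , j)} refl | yes refl = refl

  localise-outside : ∀ i {i'} j → i' ≢ i → localise i (just (i' , j)) ≡ nothing
  localise-outside i {i'} j i'≢i with i' FinP.≟ i
  ... | yes i'≡i = ⊥-elim (i'≢i i'≡i)
  ... | no _     = refl

  module _ (i : Fin u) where
    open ColourMatching FinP._≟_ (MaybeP.≡-dec FinP._≟_) FinP._≟_ colK (colP ∘ inGroup i)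

    opaque
      matchGroup : ColourBijection (allFin n) (nothing ∷ map just (allFin m))
      matchGroup = colourBijection (allFin-enumerates n) (maybe-enumerates FinP._≟_ {allFin m} (allFin-enumerates m)) sizes
        where
        sizes : ∀ k → ∑[ z ∈ allFin n ] 𝟙 (colK z FinP.≟ k) ≡ ∑[ w ∈ nothing ∷ map just (allFin m) ] 𝟙 (colP (inGroup i w) FinP.≟ k)
        sizes k = begin
          ∑[ z ∈ allFin n ] 𝟙 (colK z FinP.≟ k)                 ≡⟨ sym (length-filter≡∑𝟙 _ (allFin n)) ⟩
          colourCount colK (allFin n) k                        ≡⟨ proj₂ κ-spec k ⟩
          𝟙 (κ FinP.≟ k) + g                                    ≡⟨ cong (𝟙 (κ FinP.≟ k) +_) (sym (group-colour-sizes i k)) ⟩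
          𝟙 (κ FinP.≟ k) + colourCount col (groupPts i) k        ≡⟨ cong (𝟙 (κ FinP.≟ k) +_) (trans (length-filter≡∑𝟙 (λ p → col p FinP.≟ k) (groupPts i))
                                                                     (trans (∑-map _ (i ,_) (allFin m)) (sym (∑-map _ just (allFin m))))) ⟩
          ∑[ w ∈ nothing ∷ map just (allFin m) ] 𝟙 (colP (inGroup i w) FinP.≟ k) ∎
          where open ≡-Reasoning

    open ColourBijection matchGroup public
      using () renaming (to to β; from to β⁻¹; from-to to β⁻¹∘β; to-from to β∘β⁻¹; colour-to to colP∘ψ)

  ψ : Fin u → Fin n → P
  ψ i = inGroup i ∘ β i

  ρ : Fin u → P → Maybe (Fin n)
  ρ i = Data.Maybe.map (β⁻¹ i) ∘ localise i

  ρ∘ψ : ∀ i z → ρ i (ψ i z) ≡ just z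
  ρ∘ψ i z = trans (cong (Data.Maybe.map (β⁻¹ i)) (localise-inGroup i (β i z))) (cong just (β⁻¹∘β i z))

  ψ∘ρ : ∀ i {p z} → ρ i p ≡ just z → ψ i z ≡ p
  ψ∘ρ i {p} eq with localise i p in loc
  ψ∘ρ i {p} refl | just w = trans (cong (inGroup i) (β∘β⁻¹ i w)) (inGroup-localise i loc)

  ρ-∞ : ∀ i → ρ i nothing ≡ just (β⁻¹ i nothing)
  ρ-∞ i = refl

  ρ-own : ∀ i j → ρ i (just (i , j)) ≡ just (β⁻¹ i (just j))
  ρ-own i j = cong (Data.Maybe.map (β⁻¹ i)) (localise-inGroup i (just j))

  ρ-other : ∀ i {i'} j → i' ≢ i → ρ i (just (i' , j)) ≡ nothing
  ρ-other i j i'≢i = cong (Data.Maybe.map (β⁻¹ i)) (localise-outside i j i'≢i)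

  holeCount≡r : ∀ i → FrameCounting.holeCount F i ≡ K.r
  holeCount≡r i = *-cancelˡ-≡ _ _ 2 (trans (holeCount-uniform F i) (sym (KTS-replication {m} K)))

  module Holes = ColourMatching FinP._≟_ (ProdP.≡-dec FinP._≟_ (FinP._≟_ {K.r})) FinP._≟_ F.hole proj₁

  opaque
    matchHoles : Holes.ColourBijection (allFin F.r) (cartesianProduct (allFin u) (allFin K.r))
    matchHoles = Holes.colourBijection (allFin-enumerates F.r)
      (×-enumerates FinP._≟_ FinP._≟_ {allFin u} {allFin K.r} (allFin-enumerates u) (allFin-enumerates K.r)) sizes
      where
      sizes : ∀ i → ∑[ j ∈ allFin F.r ] 𝟙 (F.hole j FinP.≟ i) ≡ ∑[ ik ∈ cartesianProduct (allFin u) (allFin K.r) ] 𝟙 (proj₁ ik FinP.≟ i)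
      sizes i = begin
        FrameCounting.holeCount F i                              ≡⟨ holeCount≡r i ⟩
        K.r                                                      ≡⟨ sym (*-identityˡ K.r) ⟩
        1 * K.r                                                  ≡⟨ cong (_* K.r) (sym (allFin-enumerates u i)) ⟩
        ∑[ i' ∈ allFin u ] 𝟙 (i' FinP.≟ i) * K.r                  ≡⟨ sym (∑-*ʳ K.r (λ i' → 𝟙 (i' FinP.≟ i)) (allFin u)) ⟩
        ∑[ i' ∈ allFin u ] (𝟙 (i' FinP.≟ i) * K.r)                ≡⟨ ∑-cong (allFin u) (λ i' → trans (*-comm (𝟙 (i' FinP.≟ i)) K.r) (trans (cong (_* 𝟙 (i' FinP.≟ i)) (sym (length-allFin K.r)))
                                                                                              (sym (∑-const _ (allFin K.r))))) ⟩
        ∑[ i' ∈ allFin u ] ∑[ _ ∈ allFin K.r ] 𝟙 (i' FinP.≟ i)    ≡⟨ sym (∑-cartesianProduct _ (allFin u) (allFin K.r)) ⟩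
        ∑[ ik ∈ cartesianProduct (allFin u) (allFin K.r) ] 𝟙 (proj₁ ik FinP.≟ i) ∎
        where open ≡-Reasoning

  open Holes.ColourBijection matchHoles
    using () renaming (to to σ; from to σ⁻¹; to-from to σ∘σ⁻¹; colour-to to hole-σ; ∑-to to ∑-σ)

  module Frame = Relabel _≟F_ _≟P_ just id (λ _ → refl) sym
  module Copy (i : Fin u) = Relabel FinP._≟_ _≟P_ (ψ i) (ρ i) (ρ∘ψ i) (ψ∘ρ i)
  open Counting _≟P_

  copy : Fin u × Fin K.r → List (Triple P)
  copy ik = map (Copy.relabel (proj₁ ik)) (K.classes (proj₂ ik))

  classesP : Fin F.r → List (Triple P)
  classesP j = map Frame.relabel (F.classes j) ++ copy (σ j)

  blocksP : List (Triple P)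
  blocksP = concatMap classesP (allFin F.r)

  parallelP : ∀ j p → countPt p (classesP j) ≡ 1
  parallelP j p = trans (length-filter-++ _ (map Frame.relabel (F.classes j)) (copy (σ j))) (split p)
    where
    i = proj₁ (σ j)
    k = proj₂ (σ j)
    inCopy : ∀ {p z} → ρ i p ≡ just z → countPt p (copy (σ j)) ≡ 1
    inCopy ρp≡z = trans (Copy.countPt-relabel i ρp≡z (K.classes k)) (K.parallel k _)
    split : ∀ p → countPt p (map Frame.relabel (F.classes j)) + countPt p (copy (σ j)) ≡ 1
    split nothing = cong₂ _+_ (Frame.countPt-relabel-∉ refl (F.classes j)) (inCopy (ρ-∞ i))
    split (just (i' , j')) with i' FinP.≟ i
    ... | yes refl = cong₂ _+_ (trans (Frame.countPt-relabel refl (F.classes j)) (proj₁ (F.partialParallel j (i' , j')) (hole-σ j)))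
                               (inCopy (ρ-own i j'))
    ... | no i'≢i  = cong₂ _+_ (trans (Frame.countPt-relabel refl (F.classes j))
                                      (proj₂ (F.partialParallel j (i' , j')) (λ e → i'≢i (trans e (sym (hole-σ j))))))
                               (Copy.countPt-relabel-∉ i (ρ-other i j' i'≢i) (K.classes k))

  copyPairs : Fin u → P → P → ℕ
  copyPairs i p q = countPair p q (map (Copy.relabel i) K.blocks)

  countPair-blocksP : ∀ p q → countPair p q blocksP ≡ countPair p q (map Frame.relabel F.blocks) + ∑[ i ∈ allFin u ] copyPairs i p q
  countPair-blocksP p q = begin
    countPair p q blocksP
      ≡⟨ length-filter-concatMap _ classesP (allFin F.r) ⟩
    ∑[ j ∈ allFin F.r ] countPair p q (classesP j)
      ≡⟨ ∑-cong (allFin F.r) (λ j → length-filter-++ _ (map Frame.relabel (F.classes j)) (copy (σ j))) ⟩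
    ∑[ j ∈ allFin F.r ] (countPair p q (map Frame.relabel (F.classes j)) + inCopy (σ j))
      ≡⟨ ∑-+ _ (inCopy ∘ σ) (allFin F.r) ⟩
    ∑[ j ∈ allFin F.r ] countPair p q (map Frame.relabel (F.classes j)) + ∑ (inCopy ∘ σ) (allFin F.r)
      ≡⟨ cong₂ _+_ (sym (length-filter-concatMap _ (map Frame.relabel ∘ F.classes) (allFin F.r))) (∑-σ inCopy) ⟩
    countPair p q (concatMap (map Frame.relabel ∘ F.classes) (allFin F.r)) + ∑ inCopy (cartesianProduct (allFin u) (allFin K.r))
      ≡⟨ cong₂ _+_ (cong (countPair p q) (sym (ListP.map-concatMap Frame.relabel F.classes (allFin F.r))))
                   (trans (∑-cartesianProduct inCopy (allFin u) (allFin K.r)) (∑-cong (allFin u) copyPairs≡)) ⟩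
    countPair p q (map Frame.relabel F.blocks) + ∑[ i ∈ allFin u ] copyPairs i p q ∎
    where
    open ≡-Reasoning
    inCopy : Fin u × Fin K.r → ℕ
    inCopy ik = countPair p q (copy ik)
    copyPairs≡ : ∀ i → ∑[ k ∈ allFin K.r ] inCopy (i , k) ≡ copyPairs i p q
    copyPairs≡ i = trans (sym (length-filter-concatMap _ (map (Copy.relabel i) ∘ K.classes) (allFin K.r)))
                         (cong (countPair p q) (sym (ListP.map-concatMap (Copy.relabel i) K.classes (allFin K.r))))

  copyPairs-both : ∀ i {p q x y} → ρ i p ≡ just x → ρ i q ≡ just y → p ≢ q → copyPairs i p q ≡ 1
  copyPairs-both i ρp≡x ρq≡y p≢q = trans (Copy.countPair-relabel i ρp≡x ρq≡y K.blocks)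
    (K.steiner _ _ (λ { refl → p≢q (trans (sym (ψ∘ρ i ρp≡x)) (ψ∘ρ i ρq≡y)) }))

  ∑-copyPairs-single : ∀ {p q} i → (∀ i' → i' ≢ i → copyPairs i' p q ≡ 0) → copyPairs i p q ≡ 1 →
                       ∑[ i' ∈ allFin u ] copyPairs i' p q ≡ 1
  ∑-copyPairs-single i others own = trans (Enumeration.∑-point FinP._≟_ {allFin u} (allFin-enumerates u) _ i others) own

  steinerP : ∀ p q → p ≢ q → countPair p q blocksP ≡ 1
  steinerP p q p≢q = trans (countPair-blocksP p q) (split p q p≢q)
    where
    split : ∀ p q → p ≢ q → countPair p q (map Frame.relabel F.blocks) + ∑[ i ∈ allFin u ] copyPairs i p q ≡ 1
    split nothing nothing p≢q = ⊥-elim (p≢q refl)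
    split nothing (just (i' , j')) p≢q = cong₂ _+_ (Frame.countPair-relabel-∉ˡ _ refl F.blocks)
      (∑-copyPairs-single i' (λ i i≢i' → Copy.countPair-relabel-∉ʳ i nothing (ρ-other i j' (i≢i' ∘ sym)) K.blocks)
                             (copyPairs-both i' (ρ-∞ i') (ρ-own i' j') p≢q))
    split (just (i' , j')) nothing p≢q = cong₂ _+_ (Frame.countPair-relabel-∉ʳ _ refl F.blocks)
      (∑-copyPairs-single i' (λ i i≢i' → Copy.countPair-relabel-∉ˡ i nothing (ρ-other i j' (i≢i' ∘ sym)) K.blocks)
                             (copyPairs-both i' (ρ-own i' j') (ρ-∞ i') p≢q))
    split (just (i₁ , j₁)) (just (i₂ , j₂)) p≢q with i₁ FinP.≟ i₂
    ... | yes refl = cong₂ _+_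
      (trans (Frame.countPair-relabel refl refl F.blocks) (FrameCounting.countPair-sameGroup F _ _ refl (p≢q ∘ cong just)))
      (∑-copyPairs-single i₁ (λ i i≢i₁ → Copy.countPair-relabel-∉ˡ i _ (ρ-other i j₁ (i≢i₁ ∘ sym)) K.blocks)
                             (copyPairs-both i₁ (ρ-own i₁ j₁) (ρ-own i₁ j₂) p≢q))
    ... | no i₁≢i₂ = cong₂ _+_ (trans (Frame.countPair-relabel refl refl F.blocks) (F.gdd _ _ i₁≢i₂)) (∑-0 _ (allFin u) outside)
      where
      outside : ∀ i → copyPairs i (just (i₁ , j₁)) (just (i₂ , j₂)) ≡ 0
      outside i with i₁ FinP.≟ i
      ... | yes refl = Copy.countPair-relabel-∉ʳ i _ (ρ-other i j₂ (i₁≢i₂ ∘ sym)) K.blocks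
      ... | no i₁≢i  = Copy.countPair-relabel-∉ˡ i _ (ρ-other i j₁ i₁≢i) K.blocks

  properP : Proper blocksP colP
  properP = All-concatMap⁺ classesP (allFin F.r) (λ j → AllP.++⁺
    (Proper-relabel just Frame.ψ-injective (λ _ → refl) (All-concatMap⁻ F.classes (allFin F.r) col-proper (∈-allFin j)))
    (Proper-relabel (ψ _) (Copy.ψ-injective _) (colP∘ψ _) (All-concatMap⁻ K.classes (allFin K.r) colK-proper (∈-allFin _))))

  N : ℕ
  N = 4 * g * u + 1

  points : List P
  points = nothing ∷ map just (cartesianProduct (allFin u) (allFin m))

  length-points : length points ≡ N
  length-points = begin
    suc (length (map just (cartesianProduct (allFin u) (allFin m))))  ≡⟨ cong suc (ListP.length-map just (cartesianProduct (allFin u) (allFin m))) ⟩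
    suc (length (cartesianProduct (allFin u) (allFin m)))             ≡⟨ cong suc (sym (∑-1 (cartesianProduct (allFin u) (allFin m)))) ⟩
    suc (∑[ _ ∈ cartesianProduct (allFin u) (allFin m) ] 1)           ≡⟨ cong suc (∑-cartesianProduct (λ _ → 1) (allFin u) (allFin m)) ⟩
    suc (∑[ _ ∈ allFin u ] ∑[ _ ∈ allFin m ] 1)                        ≡⟨ cong suc (∑-cong (allFin u) (λ _ → trans (∑-1 (allFin m)) (length-allFin m))) ⟩
    suc (∑[ _ ∈ allFin u ] m)                                          ≡⟨ cong suc (trans (∑-const m (allFin u)) (cong (_* m) (length-allFin u))) ⟩
    suc (u * m)                                                        ≡⟨ solve-N u g ⟩
    N                                                                  ∎
    where
    open ≡-Reasoning
    solve-N : ∀ u g → suc (u * (4 * g)) ≡ 4 * g * u + 1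
    solve-N = solve-∀

  module Numbering = ColourMatching (FinP._≟_ {N}) _≟P_ UnitP._≟_ (λ _ → tt) (λ _ → tt)

  opaque
    numbering : Numbering.ColourBijection (allFin N) points
    numbering = Numbering.colourBijection (allFin-enumerates N)
      (maybe-enumerates _≟F_ {cartesianProduct (allFin u) (allFin m)}
        (×-enumerates FinP._≟_ FinP._≟_ {allFin u} {allFin m} (allFin-enumerates u) (allFin-enumerates m)))
      (λ _ → trans (∑-1 (allFin N)) (trans (length-allFin N) (trans (sym length-points) (sym (∑-1 points)))))

  open Numbering.ColourBijection numbering
    using () renaming (to to τ; from to τ⁻¹; from-to to τ⁻¹∘τ; to-from to τ∘τ⁻¹; ∑-to to ∑-τ)

  τ-injective : ∀ {z z'} → τ z ≡ τ z' → z ≡ z'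
  τ-injective {z} {z'} e = trans (sym (τ⁻¹∘τ z)) (trans (cong τ⁻¹ e) (τ⁻¹∘τ z'))

  module Final = Relabel _≟P_ FinP._≟_ τ⁻¹ (just ∘ τ) (λ p → cong just (τ∘τ⁻¹ p))
                         (λ {z} eq → trans (cong τ⁻¹ (sym (MaybeP.just-injective eq))) (τ⁻¹∘τ z))

  KN : KTS N
  KN = record
    { r        = F.r
    ; classes  = λ j → map Final.relabel (classesP j)
    ; parallel = λ j z → trans (Final.countPt-relabel refl (classesP j)) (parallelP j (τ z))
    ; steiner  = λ z z' z≢z' → trans (cong (Counting.countPair FinP._≟_ z z') (sym blocksN≡))
                                     (trans (Final.countPair-relabel refl refl blocksP) (steinerP _ _ (z≢z' ∘ τ-injective)))
    }
    where
    blocksN≡ : map Final.relabel blocksP ≡ concatMap (map Final.relabel ∘ classesP) (allFin F.r)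
    blocksN≡ = ListP.map-concatMap Final.relabel classesP (allFin F.r)

  colN : Fin N → Fin 4
  colN = colP ∘ τ

  properN : Proper (KTS.blocks KN) colN
  properN = subst (λ bs → Proper bs colN) (ListP.map-concatMap Final.relabel classesP (allFin F.r))
                  (Proper-relabel τ⁻¹ Final.ψ-injective (λ p → cong colP (τ∘τ⁻¹ p)) properP)

  colourCount-colN : ∀ k → colourCount colN (allFin N) k ≡ 𝟙 (κ FinP.≟ k) + u * g
  colourCount-colN k = begin
    colourCount colN (allFin N) k                                        ≡⟨ length-filter≡∑𝟙 (λ z → colN z FinP.≟ k) (allFin N) ⟩
    ∑[ z ∈ allFin N ] 𝟙 (colP (τ z) FinP.≟ k)                             ≡⟨ ∑-τ (λ p → 𝟙 (colP p FinP.≟ k)) ⟩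
    𝟙 (κ FinP.≟ k) + ∑[ p ∈ map just (cartesianProduct (allFin u) (allFin m)) ] 𝟙 (colP p FinP.≟ k)
      ≡⟨ cong (𝟙 (κ FinP.≟ k) +_) (trans (∑-map (λ p → 𝟙 (colP p FinP.≟ k)) just (cartesianProduct (allFin u) (allFin m))) (∑-cartesianProduct (λ p → 𝟙 (col p FinP.≟ k)) (allFin u) (allFin m))) ⟩
    𝟙 (κ FinP.≟ k) + ∑[ i ∈ allFin u ] ∑[ j ∈ allFin m ] 𝟙 (col (i , j) FinP.≟ k)
      ≡⟨ cong (𝟙 (κ FinP.≟ k) +_) (∑-cong (allFin u) group-size) ⟩
    𝟙 (κ FinP.≟ k) + ∑[ _ ∈ allFin u ] g                                 ≡⟨ cong (𝟙 (κ FinP.≟ k) +_) (trans (∑-const g (allFin u)) (cong (_* g) (length-allFin u))) ⟩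
    𝟙 (κ FinP.≟ k) + u * g                                               ∎
    where
    open ≡-Reasoning
    group-size : ∀ i → ∑[ j ∈ allFin m ] 𝟙 (col (i , j) FinP.≟ k) ≡ g
    group-size i = trans (sym (∑-map _ (i ,_) (allFin m)))
                         (trans (sym (length-filter≡∑𝟙 (λ p → col p FinP.≟ k) (groupPts i))) (group-colour-sizes i k))

  equitableN : EquitableOn colN (allFin N)
  equitableN k k' = subst₂ (λ c c' → c ≤ suc c') (sym (colourCount-colN k)) (sym (colourCount-colN k'))
                           (+-mono-≤ (𝟙≤1 (κ FinP.≟ k)) (m≤n+m (u * g) (𝟙 (κ FinP.≟ k'))))

  not-3-colourable : ∀ δ → δ < 4 → ¬ Colourable (KTS.blocks KN) δ
  not-3-colourable δ δ<4 (c , c-proper) =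
    K-not-3-colourable δ δ<4 (c ∘ τ⁻¹ ∘ ψ i₀ , All-concatMap⁺ K.classes (allFin K.r) classProper)
    where
    i₀ : Fin u
    i₀ = Fin.zero
    classProper : ∀ k → Proper (K.classes k) (c ∘ τ⁻¹ ∘ ψ i₀)
    classProper k = AllP.map⁻ (subst (λ ik → Proper (copy ik) (c ∘ τ⁻¹)) (σ∘σ⁻¹ (i₀ , k))
                      (AllP.++⁻ʳ (map Frame.relabel (F.classes j)) (AllP.map⁻ inClass)))
      where
      j = σ⁻¹ (i₀ , k)
      inClass : Proper (map Final.relabel (classesP j)) c
      inClass = All-concatMap⁻ (map Final.relabel ∘ classesP) (allFin F.r) c-proper (∈-allFin j)

  good : Good4KTS N
  good = KN , ((colN , properN) , not-3-colourable) , colN , properN , equitableN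

no-triple-on-Fin1 : ¬ Triple (Fin 1)
no-triple-on-Fin1 (tri Fin.zero Fin.zero _ a≢b _ _) = a≢b refl

lemma4p3 : ∀ (g u : ℕ) → 1 ≤ u →
    (Σ (KirkmanFrame (4 * g) u) λ F →
       Σ (FPt (4 * g) u → Fin 4) λ col →
         Proper (KirkmanFrame.blocks F) col × (∀ (i : Fin u) → EquitableOn col (groupPts i))) →
    Good4KTS (4 * g + 1) →
    Good4KTS (4 * g * u + 1)
lemma4p3 zero u _ _ (K , (_ , K-not-3-colourable) , _) =
  ⊥-elim (K-not-3-colourable 1 (s≤s (s≤s z≤n)) ((λ _ → Fin.zero) , All.universal (⊥-elim ∘ no-triple-on-Fin1) (KTS.blocks K)))
lemma4p3 (suc g') (suc zero) _ _ K = subst (λ t → Good4KTS (t + 1)) (sym (*-identityʳ (4 * suc g'))) K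
lemma4p3 (suc g') (suc (suc v)) _ (F , col , col-proper , col-equitable)
         (K , (_ , K-not-3-colourable) , colK , colK-proper , colK-equitable) =
  Construction.good F col col-proper col-equitable K K-not-3-colourable colK colK-proper colK-equitable
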